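{- Consider a Constrained Connectivity instance with vertex set $V$ whose safe sets are symmetric and hierarchical, and let $\{x,y\}$ be a hard pair. Then $S(u,v)\subseteq S(x,y)$ for all $u,v\in S(x,y)$.
   Context: Safe sets: for each pair $(u,v)\in V\times V$ a set $S(u,v)\subseteq V$ with $u,v\in S(u,v)$. They are symmetric if $S(x,y)=S(y,x)$ for all $x,y$, and hierarchical if for all $x,y,z$, $z\in S(x,y)$ implies $S(x,z)\subseteq S(x,y)$ and $S(z,y)\subseteq S(x,y)$. A pair $\{x,y\}$ is easy if there is some $z\in S(x,y)$ with $S(x,z)\subsetneq S(x,y)$ and $S(y,z)\subsetneq S(x,y)$; otherwise it is hard. -}

module Defs where

open import Level using (0ℓ)
open import Data.Nat using (ℕ)
open import Data.Fin using (Fin)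
open import Data.Product using (_×_; ∃-syntax)
open import Relation.Nullary using (¬_; Dec)
open import Relation.Unary using (Pred; _∈_; _⊆_)
open import Relation.Binary.PropositionalEquality using (_≡_)

SafeSets : ℕ → Set₁
SafeSets n = Fin n → Fin n → Pred (Fin n) 0ℓ

ContainsEnds : ∀ {n} → SafeSets n → Set
ContainsEnds S = ∀ u v → (u ∈ S u v) × (v ∈ S u v)

_⊊_ : ∀ {n} → Pred (Fin n) 0ℓ → Pred (Fin n) 0ℓ → Set
A ⊊ B = (A ⊆ B) × ¬ (B ⊆ A)

Symmetric : ∀ {n} → SafeSets n → Set
Symmetric S = ∀ x y → (S x y ⊆ S y x) × (S y x ⊆ S x y)

Hierarchical : ∀ {n} → SafeSets n → Set
Hierarchical S = ∀ x y z → z ∈ S x y → (S x z ⊆ S x y) × (S z y ⊆ S x y)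

Easy : ∀ {n} → SafeSets n → Fin n → Fin n → Set
Easy S x y = ∃[ z ] ((z ∈ S x y) × (S x z ⊊ S x y) × (S y z ⊊ S x y))

Hard : ∀ {n} → SafeSets n → Fin n → Fin n → Set
Hard S x y = ¬ Easy S x y

-- Membership in each safe set is decidable (safe sets are concrete finite
-- subsets of the finite vertex set in the paper).
DecidableSafeSets : ∀ {n} → SafeSets n → Set
DecidableSafeSets S = ∀ u v w → Dec (w ∈ S u v)

module Submission where

-- Let {x,y} be hard and u,v ∈ S(x,y); we show every
-- w ∈ S(u,v) lies in S(x,y).  Membership is decidable, so it suffices to
-- refute w ∉ S(x,y).
--   * By hierarchy (and symmetry for the y-side), u ∈ S(x,y) gives
--     S(x,u) ⊆ S(x,y) and S(y,u) ⊆ S(x,y).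
--   * Since {x,y} is hard, the witness z = u cannot make both inclusions
--     strict: S(x,y) ⊆ S(x,u) or S(x,y) ⊆ S(y,u) must hold (in the doubly
--     negated sense; see 'hard-pair-splits').
--   * If S(a,u) = S(x,y) for a ∈ {x,y}, then v ∈ S(a,u), and hierarchy with
--     symmetry gives S(u,v) ⊆ S(a,u) = S(x,y) ('equal-safe-set-traps').
-- So w ∉ S(x,y) refutes both alternatives, and lemma24 follows.

open import Defs
open import Data.Nat using (ℕ)
open import Data.Fin using (Fin)
open import Data.Empty using (⊥)
open import Data.Product using (_,_; proj₁; proj₂)
open import Relation.Nullary using (¬_)
open import Relation.Nullary.Decidable using (decidable-stable)
open import Relation.Unary using (_∈_; _⊆_)

module _ {n : ℕ} {S : SafeSets n} (sym : Symmetric S) (hier : Hierarchical S) where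

  hierarchical-right : ∀ x y z → z ∈ S x y → S y z ⊆ S x y
  hierarchical-right x y z z∈Sxy w∈Syz =
    proj₂ (hier x y z z∈Sxy) (proj₁ (sym y z) w∈Syz)

  equal-safe-set-traps : ∀ x y a u v → S a u ⊆ S x y → S x y ⊆ S a u →
                         v ∈ S x y → S u v ⊆ S x y
  equal-safe-set-traps x y a u v Sau⊆Sxy Sxy⊆Sau v∈Sxy w∈Suv =
    Sau⊆Sxy (hierarchical-right a u v (Sxy⊆Sau v∈Sxy) w∈Suv)

  hard-pair-splits : ∀ x y z → Hard S x y → z ∈ S x y →
                     ¬ (S x y ⊆ S x z) → ¬ (S x y ⊆ S y z) → ⊥
  hard-pair-splits x y z hard z∈Sxy ¬Sxy⊆Sxz ¬Sxy⊆Syz =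
    hard (z , z∈Sxy , (proj₁ (hier x y z z∈Sxy) , ¬Sxy⊆Sxz)
                    , (hierarchical-right x y z z∈Sxy , ¬Sxy⊆Syz))

lemma24 : (n : ℕ) (S : SafeSets n) → DecidableSafeSets S → ContainsEnds S → Symmetric S → Hierarchical S →
    (x y : Fin n) → Hard S x y →
    (u v : Fin n) → u ∈ S x y → v ∈ S x y → S u v ⊆ S x y
lemma24 n S dec _ sym hier x y hard u v u∈Sxy v∈Sxy {w} w∈Suv =
  decidable-stable (dec x y w) λ w∉Sxy →
    let
        Sxy⊈Sxu : ¬ (S x y ⊆ S x u)
        Sxy⊈Sxu Sxy⊆Sxu = w∉Sxy
          (equal-safe-set-traps sym hier x y x u v
             (proj₁ (hier x y u u∈Sxy)) Sxy⊆Sxu v∈Sxy w∈Suv)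
        Sxy⊈Syu : ¬ (S x y ⊆ S y u)
        Sxy⊈Syu Sxy⊆Syu = w∉Sxy
          (equal-safe-set-traps sym hier x y y u v
             (hierarchical-right sym hier x y u u∈Sxy) Sxy⊆Syu v∈Sxy w∈Suv)
    in hard-pair-splits sym hier x y u hard u∈Sxy Sxy⊈Sxu Sxy⊈Syu
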